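{- Let $G=(V,E)$ be a connected non-bipartite graph and $k\geq 2$ an integer. Let $c:V\to\mathbb{Z}_k$ be a proper vertex coloring of $G$ which is almost induced by an edge coloring $s:E\to\mathbb{Z}_k$ with defective vertex $v$. Then for every $x\in\mathbb{Z}_k$ such that $c(u)\neq c_s(v)+2x \pmod k$ for all $u\in N_G(v)$, the vertex coloring $c'$ obtained from $c$ by setting $c'(v)=c_s(v)+2x \bmod k$ and $c'(u)=c(u)$ for $u\neq v$ is induced by an improper twin $k$-edge coloring of $G$, i.e. there is $s':E\to\mathbb{Z}_k$ with $c_{s'}=c'$.
   Context: $N_G(v)$ is the open neighbourhood of $v$. For an edge coloring $s:E\to\mathbb{Z}_k$, $c_s(u)=\sum_{e\in E_u}s(e)$ computed in $\mathbb{Z}_k$, where $E_u$ is the set of edges incident to $u$. The edge coloring $s$ almost induces $c$ with defective vertex $v$ if $c_s(u)=c(u)$ for all $u\in V\setminus\{v\}$. An improper twin $k$-edge coloring is a map $s:E\to\mathbb{Z}_k$ (not necessarily a proper edge coloring) such that $c_s$ is a proper vertex coloring; it induces the vertex coloring $c_s$. -}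

module Defs where

open import Data.Nat using (ℕ; zero; suc; _+_; _*_; NonZero)
open import Data.Nat.DivMod using (_mod_)
open import Data.Fin using (Fin; toℕ)
open import Data.List using (List; map; allFin)
open import Data.Nat.ListAction using (sum)
open import Data.Bool using (Bool; if_then_else_)
open import Data.Product using (Σ; ∃; _×_; _,_)
open import Relation.Nullary using (¬_; Dec; does)
open import Relation.Binary.PropositionalEquality using (_≡_; _≢_)

record Graph (n : ℕ) : Set₁ where
  field
    Adj    : Fin n → Fin n → Set
    adj?   : ∀ u w → Dec (Adj u w)
    sym    : ∀ {u w} → Adj u w → Adj w u
    irrefl : ∀ {u} → ¬ Adj u u
open Graph public

data Reach {n : ℕ} (G : Graph n) : Fin n → Fin n → Set where
  here : ∀ {u} → Reach G u u
  step : ∀ {u w x} → Adj G u w → Reach G w x → Reach G u x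

Connected : ∀ {n} → Graph n → Set
Connected G = ∀ u w → Reach G u w

Bipartite : ∀ {n} → Graph n → Set
Bipartite {n} G = Σ (Fin n → Bool) λ f → ∀ u w → Adj G u w → f u ≢ f w

-- Z_k is represented by Fin k, with arithmetic mod k.
-- An edge colouring s : E → Z_k is represented by a symmetric function on
-- pairs of vertices; only its values on edges {u,w} (Adj u w) are used.
record EdgeColouring {n : ℕ} (G : Graph n) (k : ℕ) : Set where
  field
    col     : Fin n → Fin n → Fin k
    col-sym : ∀ u w → col u w ≡ col w u
open EdgeColouring public

inducedColour : ∀ {n} {G : Graph n} (k : ℕ) .{{_ : NonZero k}} →
                EdgeColouring G k → Fin n → Fin k
inducedColour {n} {G} k s u =
  sum (map (λ w → if does (adj? G u w) then toℕ (col s u w) else 0) (allFin n)) mod k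

ProperVertexColouring : ∀ {n} (G : Graph n) (k : ℕ) → (Fin n → Fin k) → Set
ProperVertexColouring G k c = ∀ u w → Adj G u w → c u ≢ c w

AlmostInduces : ∀ {n} {G : Graph n} (k : ℕ) .{{_ : NonZero k}} →
                EdgeColouring G k → (Fin n → Fin k) → Fin n → Set
AlmostInduces k s c v = ∀ u → u ≢ v → inducedColour k s u ≡ c u

Induces : ∀ {n} {G : Graph n} (k : ℕ) .{{_ : NonZero k}} →
          EdgeColouring G k → (Fin n → Fin k) → Set
Induces k s c = ∀ u → inducedColour k s u ≡ c u

shifted : (k : ℕ) .{{_ : NonZero k}} → Fin k → Fin k → Fin k
shifted k a x = (toℕ a + 2 * toℕ x) mod k

recolour : ∀ {n k} → (Fin n → Fin k) → Fin n → Fin k → Fin n → Fin k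
recolour {n} c v a u with does (u Data.Fin.≟ v)
... | Data.Bool.true  = a
... | Data.Bool.false = c u

-- Walk once around an odd closed walk through v, adding y = x and z = −x to its
-- edges alternately. Each passage of the walk through a vertex uses two consecutive
-- edges and so contributes y + z ≡ 0; only at v, where the odd walk both starts
-- and ends with a y-edge, the induced colour grows by 2x. An odd closed walk through
-- v exists because G is connected and not bipartite.
module Submission where

open import Defs
open import Function using (_∘_; id)
open import Data.Nat using (ℕ; zero; suc; _+_; _*_; _∸_; _%_; _≤_; NonZero)
open import Data.Nat.Properties
  using (+-*-semiring; +-comm; +-identityʳ; *-identityˡ; *-zeroʳ; *-comm; *-distribˡ-+; m+[n∸m]≡n; <⇒≤)
open import Data.Nat.DivMod using (_mod_; %-distribˡ-+; %-distribˡ-*; m%n%n≡m%n; %-remove-+ʳ; m<n⇒m%n≡m)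
open import Data.Nat.Divisibility using (_∣_; ∣m∣n⇒∣m+n; ∣-trans; ∣-reflexive; n∣m*n)
import Data.Nat.ListAction as List
open import Data.Nat.Tactic.RingSolver using (solve-∀)
open import Data.Fin using (Fin; zero; suc; toℕ; _≟_)
open import Data.Fin.Properties using (toℕ-fromℕ<; toℕ-injective; toℕ<n; any?)
open import Data.List using (map; tabulate; allFin)
open import Data.List.Properties using (map-tabulate)
open import Data.Bool using (Bool; true; false; not; _xor_; if_then_else_)
open import Data.Bool.Properties using (xor-comm; xor-same; not-distribˡ-xor; not-distribʳ-xor; if-not)
  renaming (_≟_ to _≟ᵇ_)
open import Data.Product using (Σ; _,_; proj₁; proj₂)
open import Relation.Nullary using (¬_; Dec; yes; no; does; contradiction)
open import Relation.Nullary.Decidable using (_×-dec_)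
open import Relation.Binary.PropositionalEquality
  using (_≡_; _≢_; refl; trans; cong; cong₂; subst; module ≡-Reasoning)
import Relation.Binary.PropositionalEquality as ≡
open import Algebra.Properties.Semiring.Sum +-*-semiring
  using (sum-syntax; sum-cong-≗; ∑-distrib-+; sum-replicate-zero)

open ≡-Reasoning

⟦_⟧ : ∀ {p} {P : Set p} → Dec P → ℕ
⟦ P? ⟧ = if does P? then 1 else 0

⟦⟧≡1 : ∀ {p} {P : Set p} (P? : Dec P) → P → ⟦ P? ⟧ ≡ 1
⟦⟧≡1 (yes _) _ = refl
⟦⟧≡1 (no ¬p) p = contradiction p ¬p

⟦⟧≡0 : ∀ {p} {P : Set p} (P? : Dec P) → ¬ P → ⟦ P? ⟧ ≡ 0
⟦⟧≡0 (yes p) ¬p = contradiction p ¬p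
⟦⟧≡0 (no _)  _  = refl

if-does≡⟦⟧* : ∀ {p} {P : Set p} (P? : Dec P) m → (if does P? then m else 0) ≡ ⟦ P? ⟧ * m
if-does≡⟦⟧* (yes _) m = ≡.sym (+-identityʳ m)
if-does≡⟦⟧* (no _)  m = refl

[m%d+n]%d≡[m+n]%d : ∀ m n d .{{_ : NonZero d}} → (m % d + n) % d ≡ (m + n) % d
[m%d+n]%d≡[m+n]%d m n d = begin
  (m % d + n) % d          ≡⟨ %-distribˡ-+ (m % d) n d ⟩
  (m % d % d + n % d) % d  ≡⟨ cong (λ r → (r + n % d) % d) (m%n%n≡m%n m d) ⟩
  (m % d + n % d) % d      ≡⟨ %-distribˡ-+ m n d ⟨
  (m + n) % d              ∎

-- Both n and o are congruent to −t.
[m+n]%d≡[m+o]%d : ∀ m {n o d} .{{_ : NonZero d}} t → d ∣ n + t → d ∣ t + o → (m + n) % d ≡ (m + o) % d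
[m+n]%d≡[m+o]%d m {n} {o} {d} t d∣n+t d∣t+o = begin
  (m + n) % d            ≡⟨ %-remove-+ʳ (m + n) d∣t+o ⟨
  (m + n + (t + o)) % d  ≡⟨ cong (_% d) (regroup m n o t) ⟩
  (m + o + (n + t)) % d  ≡⟨ %-remove-+ʳ (m + o) d∣n+t ⟩
  (m + o) % d            ∎
  where
  regroup : ∀ m n o t → m + n + (t + o) ≡ m + o + (n + t)
  regroup = solve-∀

List-sum-tabulate : ∀ {n} (f : Fin n → ℕ) → List.sum (tabulate f) ≡ ∑[ i < n ] f i
List-sum-tabulate {zero}  f = refl
List-sum-tabulate {suc n} f = cong (f zero +_) (List-sum-tabulate (f ∘ suc))

∑-indicator : ∀ {n} (b : Fin n) (f : Fin n → ℕ) → ∑[ i < n ] (⟦ i ≟ b ⟧ * f i) ≡ f b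
∑-indicator {suc n} zero f = begin
  1 * f zero + ∑[ i < n ] 0  ≡⟨ cong₂ _+_ (*-identityˡ (f zero)) (sum-replicate-zero n) ⟩
  f zero + 0                 ≡⟨ +-identityʳ (f zero) ⟩
  f zero                     ∎
∑-indicator {suc n} (suc b) f = ∑-indicator b (f ∘ suc)

∑-cong-% : ∀ {n} d .{{_ : NonZero d}} (f g : Fin n → ℕ) → (∀ i → f i % d ≡ g i % d) →
           (∑[ i < n ] f i) % d ≡ (∑[ i < n ] g i) % d
∑-cong-% {zero}  d f g f≡g = refl
∑-cong-% {suc n} d f g f≡g = begin
  (f zero + ∑[ i < n ] f (suc i)) % d                ≡⟨ %-distribˡ-+ (f zero) _ d ⟩
  (f zero % d + (∑[ i < n ] f (suc i)) % d) % d      ≡⟨ cong₂ (λ a b → (a + b) % d) (f≡g zero)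
                                                          (∑-cong-% d (f ∘ suc) (g ∘ suc) (f≡g ∘ suc)) ⟩
  (g zero % d + (∑[ i < n ] g (suc i)) % d) % d      ≡⟨ %-distribˡ-+ (g zero) _ d ⟨
  (g zero + ∑[ i < n ] g (suc i)) % d                ∎

module _ {n} {G : Graph n} where

  infixr 5 _◅◅_
  _◅◅_ : ∀ {a b c} → Reach G a b → Reach G b c → Reach G a c
  here     ◅◅ V = V
  step e W ◅◅ V = step e (W ◅◅ V)

  reverse : ∀ {a b} → Reach G a b → Reach G b a
  reverse here       = here
  reverse (step e W) = reverse W ◅◅ step (sym G e) here

  oddLength : ∀ {a b} → Reach G a b → Bool
  oddLength here       = false
  oddLength (step _ W) = not (oddLength W)

  oddLength-◅◅ : ∀ {a b c} (W : Reach G a b) (V : Reach G b c) →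
                 oddLength (W ◅◅ V) ≡ oddLength W xor oddLength V
  oddLength-◅◅ here       V = refl
  oddLength-◅◅ (step e W) V = trans (cong not (oddLength-◅◅ W V)) (not-distribˡ-xor (oddLength W) (oddLength V))

  oddLength-reverse : ∀ {a b} (W : Reach G a b) → oddLength (reverse W) ≡ oddLength W
  oddLength-reverse here       = refl
  oddLength-reverse (step e W) = begin
    oddLength (reverse W ◅◅ step (sym G e) here)  ≡⟨ oddLength-◅◅ (reverse W) (step (sym G e) here) ⟩
    oddLength (reverse W) xor true                ≡⟨ xor-comm (oddLength (reverse W)) true ⟩
    not (oddLength (reverse W))                   ≡⟨ cong not (oddLength-reverse W) ⟩
    not (oddLength W)                             ∎

  closedThrough : ∀ {u w v} → Reach G u v → Adj G u w → Reach G w v → Reach G v v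
  closedThrough A e B = reverse A ◅◅ step e B

  oddLength-closedThrough : ∀ {u w v} (A : Reach G u v) (e : Adj G u w) (B : Reach G w v) →
                            oddLength A ≡ oddLength B → oddLength (closedThrough A e B) ≡ true
  oddLength-closedThrough A e B same = begin
    oddLength (reverse A ◅◅ step e B)            ≡⟨ oddLength-◅◅ (reverse A) (step e B) ⟩
    oddLength (reverse A) xor not (oddLength B)  ≡⟨ cong₂ (λ p q → p xor not q) (oddLength-reverse A) (≡.sym same) ⟩
    oddLength A xor not (oddLength A)            ≡⟨ not-distribʳ-xor (oddLength A) (oddLength A) ⟨
    not (oddLength A xor oddLength A)            ≡⟨ cong not (xor-same (oddLength A)) ⟩
    true                                         ∎

oddClosedWalk : ∀ {n} (G : Graph n) → Connected G → ¬ Bipartite G →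
                ∀ v → Σ (Reach G v v) λ W → oddLength W ≡ true
oddClosedWalk G conn nonBipartite v
  with any? (λ u → any? (λ w → adj? G u w ×-dec (oddLength (conn u v) ≟ᵇ oddLength (conn w v))))
... | yes (u , w , e , same) =
  closedThrough (conn u v) e (conn w v) , oddLength-closedThrough (conn u v) e (conn w v) same
... | no noneSame =
  contradiction ((λ u → oddLength (conn u v)) , λ u w e same → noneSame (u , w , e , same)) nonBipartite

module _ {n} (G : Graph n) where

  nbrSum : Fin n → (Fin n → ℕ) → ℕ
  nbrSum u f = ∑[ w < n ] (⟦ adj? G u w ⟧ * f w)

  nbrSum-+ : ∀ u (f g : Fin n → ℕ) → nbrSum u (λ w → f w + g w) ≡ nbrSum u f + nbrSum u g
  nbrSum-+ u f g = trans (sum-cong-≗ (λ w → *-distribˡ-+ ⟦ adj? G u w ⟧ (f w) (g w))) (∑-distrib-+ {n} _ _)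

  nbrSum-zero : ∀ u → nbrSum u (λ _ → 0) ≡ 0
  nbrSum-zero u = trans (sum-cong-≗ (λ w → *-zeroʳ ⟦ adj? G u w ⟧)) (sum-replicate-zero n)

  nbrSum-cong-% : ∀ d .{{_ : NonZero d}} u (f g : Fin n → ℕ) → (∀ w → f w % d ≡ g w % d) →
                  nbrSum u f % d ≡ nbrSum u g % d
  nbrSum-cong-% d u f g f≡g = ∑-cong-% d _ _ λ w → begin
    (⟦ adj? G u w ⟧ * f w) % d                    ≡⟨ %-distribˡ-* ⟦ adj? G u w ⟧ (f w) d ⟩
    (⟦ adj? G u w ⟧ % d * (f w % d)) % d          ≡⟨ cong (λ r → (⟦ adj? G u w ⟧ % d * r) % d) (f≡g w) ⟩
    (⟦ adj? G u w ⟧ % d * (g w % d)) % d          ≡⟨ %-distribˡ-* ⟦ adj? G u w ⟧ (g w) d ⟨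
    (⟦ adj? G u w ⟧ * g w) % d                    ∎

  toℕ-inducedColour : ∀ k .{{_ : NonZero k}} (s : EdgeColouring G k) u →
                      toℕ (inducedColour k s u) ≡ nbrSum u (toℕ ∘ col s u) % k
  toℕ-inducedColour k s u = trans (toℕ-fromℕ< _) (cong (_% k) (begin
    List.sum (map weighted (allFin n))  ≡⟨ cong List.sum (map-tabulate id weighted) ⟩
    List.sum (tabulate weighted)        ≡⟨ List-sum-tabulate weighted ⟩
    ∑[ w < n ] weighted w               ≡⟨ sum-cong-≗ (λ w → if-does≡⟦⟧* (adj? G u w) (toℕ (col s u w))) ⟩
    nbrSum u (toℕ ∘ col s u)            ∎))
    where
    weighted : Fin n → ℕ
    weighted w = if does (adj? G u w) then toℕ (col s u w) else 0

edgeIndicator : ∀ {n} → Fin n → Fin n → Fin n → Fin n → ℕ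
edgeIndicator a b u w = ⟦ u ≟ a ⟧ * ⟦ w ≟ b ⟧ + ⟦ u ≟ b ⟧ * ⟦ w ≟ a ⟧

edgeIndicator-sym : ∀ {n} (a b u w : Fin n) → edgeIndicator a b u w ≡ edgeIndicator a b w u
edgeIndicator-sym a b u w =
  trans (+-comm (⟦ u ≟ a ⟧ * ⟦ w ≟ b ⟧) _) (cong₂ _+_ (*-comm ⟦ u ≟ b ⟧ _) (*-comm ⟦ u ≟ a ⟧ _))

nbrSum-edgeIndicator : ∀ {n} (G : Graph n) {a b} → Adj G a b → ∀ u y →
                       nbrSum G u (λ w → edgeIndicator a b u w * y) ≡ ⟦ u ≟ a ⟧ * y + ⟦ u ≟ b ⟧ * y
nbrSum-edgeIndicator {n} G {a} {b} ab u y = begin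
  nbrSum G u (λ w → edgeIndicator a b u w * y)
    ≡⟨ sum-cong-≗ (λ w → distribute ⟦ adj? G u w ⟧ ⟦ u ≟ a ⟧ ⟦ w ≟ b ⟧ ⟦ u ≟ b ⟧ ⟦ w ≟ a ⟧ y) ⟩
  ∑[ w < n ] (⟦ w ≟ b ⟧ * (⟦ u ≟ a ⟧ * (⟦ adj? G u w ⟧ * y)) + ⟦ w ≟ a ⟧ * (⟦ u ≟ b ⟧ * (⟦ adj? G u w ⟧ * y)))
    ≡⟨ ∑-distrib-+ {n} _ _ ⟩
  ∑[ w < n ] (⟦ w ≟ b ⟧ * (⟦ u ≟ a ⟧ * (⟦ adj? G u w ⟧ * y)))
    + ∑[ w < n ] (⟦ w ≟ a ⟧ * (⟦ u ≟ b ⟧ * (⟦ adj? G u w ⟧ * y)))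
    ≡⟨ cong₂ _+_ (∑-indicator b _) (∑-indicator a _) ⟩
  ⟦ u ≟ a ⟧ * (⟦ adj? G u b ⟧ * y) + ⟦ u ≟ b ⟧ * (⟦ adj? G u a ⟧ * y)
    ≡⟨ cong₂ _+_ (atEndpoint ab) (atEndpoint (sym G ab)) ⟩
  ⟦ u ≟ a ⟧ * y + ⟦ u ≟ b ⟧ * y  ∎
  where
  distribute : ∀ A i j i′ j′ y → A * ((i * j + i′ * j′) * y) ≡ j * (i * (A * y)) + j′ * (i′ * (A * y))
  distribute = solve-∀
  atEndpoint : ∀ {a b} → Adj G a b → ⟦ u ≟ a ⟧ * (⟦ adj? G u b ⟧ * y) ≡ ⟦ u ≟ a ⟧ * y
  atEndpoint {a} {b} ab with u ≟ a
  ... | yes refl = cong (1 *_) (trans (cong (_* y) (⟦⟧≡1 (adj? G u b) ab)) (*-identityˡ y))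
  ... | no _     = refl

module _ {n} {G : Graph n} where

  alternating : ∀ {a b} → Reach G a b → ℕ → ℕ → Fin n → Fin n → ℕ
  alternating here                  y z u w = 0
  alternating (step {a} {a′} _ W) y z u w = edgeIndicator a a′ u w * y + alternating W z y u w

  alternating-sym : ∀ {a b} (W : Reach G a b) y z u w → alternating W y z u w ≡ alternating W y z w u
  alternating-sym here                y z u w = refl
  alternating-sym (step {a} {a′} _ W) y z u w =
    cong₂ _+_ (cong (_* y) (edgeIndicator-sym a a′ u w)) (alternating-sym W z y u w)

  -- Modulo d only the neighbour sums at the ends change: a gains y ≡ −z, and b gains
  -- the value carried by the last edge.
  nbrSum-alternating : ∀ {d a b} (W : Reach G a b) {y z} → d ∣ y + z → ∀ u →
    d ∣ nbrSum G u (alternating W y z u) + ⟦ u ≟ a ⟧ * z + ⟦ u ≟ b ⟧ * (if oddLength W then z else y)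
  nbrSum-alternating {d} {a} here {y} {z} d∣y+z u = subst (d ∣_) (≡.sym (begin
    nbrSum G u (λ _ → 0) + ⟦ u ≟ a ⟧ * z + ⟦ u ≟ a ⟧ * y
      ≡⟨ cong (λ r → r + ⟦ u ≟ a ⟧ * z + ⟦ u ≟ a ⟧ * y) (nbrSum-zero G u) ⟩
    ⟦ u ≟ a ⟧ * z + ⟦ u ≟ a ⟧ * y
      ≡⟨ regroup ⟦ u ≟ a ⟧ y z ⟩
    ⟦ u ≟ a ⟧ * (y + z)  ∎)) (∣-trans d∣y+z (n∣m*n ⟦ u ≟ a ⟧))
    where
    regroup : ∀ i y z → i * z + i * y ≡ i * (y + z)
    regroup = solve-∀
  nbrSum-alternating {d} {a} {b} (step {_} {a′} e W) {y} {z} d∣y+z u =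
    subst (d ∣_) (≡.sym (begin
      nbrSum G u (λ w → edgeIndicator a a′ u w * y + alternating W z y u w) + ⟦ u ≟ a ⟧ * z
        + ⟦ u ≟ b ⟧ * (if not (oddLength W) then z else y)
          ≡⟨ cong₂ (λ r t → r + ⟦ u ≟ a ⟧ * z + ⟦ u ≟ b ⟧ * t)
                   (trans (nbrSum-+ G u _ _) (cong (_+ N) (nbrSum-edgeIndicator G e u y)))
                   (if-not (oddLength W)) ⟩
      ⟦ u ≟ a ⟧ * y + ⟦ u ≟ a′ ⟧ * y + N + ⟦ u ≟ a ⟧ * z + ⟦ u ≟ b ⟧ * end
          ≡⟨ regroup ⟦ u ≟ a ⟧ ⟦ u ≟ a′ ⟧ ⟦ u ≟ b ⟧ N y z end ⟩
      ⟦ u ≟ a ⟧ * (y + z) + (N + ⟦ u ≟ a′ ⟧ * y + ⟦ u ≟ b ⟧ * end)  ∎))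
    (∣m∣n⇒∣m+n (∣-trans d∣y+z (n∣m*n ⟦ u ≟ a ⟧)) (nbrSum-alternating W (subst (d ∣_) (+-comm y z) d∣y+z) u))
    where
    N : ℕ
    N = nbrSum G u (alternating W z y u)
    end : ℕ
    end = if oddLength W then y else z
    regroup : ∀ i j l N y z e → i * y + j * y + N + i * z + l * e ≡ i * (y + z) + (N + j * y + l * e)
    regroup = solve-∀

  nbrSum-alternating-odd : ∀ {d v} (W : Reach G v v) → oddLength W ≡ true → ∀ {y z} → d ∣ y + z → ∀ u →
                           d ∣ nbrSum G u (alternating W y z u) + ⟦ u ≟ v ⟧ * (2 * z)
  nbrSum-alternating-odd {d} {v} W odd {y} {z} d∣y+z u = subst (d ∣_) (begin
    D + ⟦ u ≟ v ⟧ * z + ⟦ u ≟ v ⟧ * (if oddLength W then z else y)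
      ≡⟨ cong (λ p → D + ⟦ u ≟ v ⟧ * z + ⟦ u ≟ v ⟧ * (if p then z else y)) odd ⟩
    D + ⟦ u ≟ v ⟧ * z + ⟦ u ≟ v ⟧ * z
      ≡⟨ regroup D ⟦ u ≟ v ⟧ z ⟩
    D + ⟦ u ≟ v ⟧ * (2 * z)  ∎) (nbrSum-alternating W d∣y+z u)
    where
    D : ℕ
    D = nbrSum G u (alternating W y z u)
    regroup : ∀ N i z → N + i * z + i * z ≡ N + i * (2 * z)
    regroup = solve-∀

shiftColouring : ∀ {n} {G : Graph n} {k} .{{_ : NonZero k}} → EdgeColouring G k →
                 (δ : Fin n → Fin n → ℕ) → (∀ u w → δ u w ≡ δ w u) → EdgeColouring G k
shiftColouring {k = k} s δ δ-sym = record
  { col     = λ u w → (toℕ (col s u w) + δ u w) mod k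
  ; col-sym = λ u w → cong₂ (λ p q → (p + q) mod k) (cong toℕ (col-sym s u w)) (δ-sym u w)
  }

toℕ-inducedColour-shift : ∀ {n} (G : Graph n) k .{{_ : NonZero k}} (s : EdgeColouring G k) δ
                          (δ-sym : ∀ u w → δ u w ≡ δ w u) u →
                          toℕ (inducedColour k (shiftColouring s δ δ-sym) u)
                            ≡ (nbrSum G u (toℕ ∘ col s u) + nbrSum G u (δ u)) % k
toℕ-inducedColour-shift G k s δ δ-sym u = begin
  toℕ (inducedColour k (shiftColouring s δ δ-sym) u)
    ≡⟨ toℕ-inducedColour G k (shiftColouring s δ δ-sym) u ⟩
  nbrSum G u (λ w → toℕ ((toℕ (col s u w) + δ u w) mod k)) % k
    ≡⟨ nbrSum-cong-% G k u _ _ (λ w → trans (cong (_% k) (toℕ-fromℕ< _)) (m%n%n≡m%n _ k)) ⟩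
  nbrSum G u (λ w → toℕ (col s u w) + δ u w) % k
    ≡⟨ cong (_% k) (nbrSum-+ G u _ _) ⟩
  (nbrSum G u (toℕ ∘ col s u) + nbrSum G u (δ u)) % k  ∎

toℕ-inducedColour-oddWalkShift :
  ∀ {n} {G : Graph n} {v} (W : Reach G v v) → oddLength W ≡ true →
  ∀ k .{{_ : NonZero k}} (s : EdgeColouring G k) {y z} → k ∣ y + z → ∀ u →
  toℕ (inducedColour k (shiftColouring s (alternating W y z) (alternating-sym W y z)) u)
    ≡ (toℕ (inducedColour k s u) + ⟦ u ≟ v ⟧ * (2 * y)) % k
toℕ-inducedColour-oddWalkShift {G = G} {v} W odd k s {y} {z} k∣y+z u = begin
  toℕ (inducedColour k (shiftColouring s (alternating W y z) (alternating-sym W y z)) u)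
    ≡⟨ toℕ-inducedColour-shift G k s _ (alternating-sym W y z) u ⟩
  (S + nbrSum G u (alternating W y z u)) % k
    ≡⟨ [m+n]%d≡[m+o]%d S (⟦ u ≟ v ⟧ * (2 * z)) (nbrSum-alternating-odd W odd k∣y+z u) k∣z-terms+y-terms ⟩
  (S + ⟦ u ≟ v ⟧ * (2 * y)) % k
    ≡⟨ [m%d+n]%d≡[m+n]%d S _ k ⟨
  (S % k + ⟦ u ≟ v ⟧ * (2 * y)) % k
    ≡⟨ cong (λ r → (r + ⟦ u ≟ v ⟧ * (2 * y)) % k) (toℕ-inducedColour G k s u) ⟨
  (toℕ (inducedColour k s u) + ⟦ u ≟ v ⟧ * (2 * y)) % k  ∎
  where
  S : ℕ
  S = nbrSum G u (toℕ ∘ col s u)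
  regroup : ∀ i y z → i * (2 * z) + i * (2 * y) ≡ i * 2 * (y + z)
  regroup = solve-∀
  k∣z-terms+y-terms : k ∣ ⟦ u ≟ v ⟧ * (2 * z) + ⟦ u ≟ v ⟧ * (2 * y)
  k∣z-terms+y-terms = subst (k ∣_) (≡.sym (regroup ⟦ u ≟ v ⟧ y z)) (∣-trans k∣y+z (n∣m*n (⟦ u ≟ v ⟧ * 2)))

-- That c is proper, that k ≥ 2 and that c′(v) avoids the colours of the neighbours of v
-- only serve to make c′ a proper colouring; s′ induces c′ without them.
lemma2 : ∀ {n : ℕ} (G : Graph n) → Connected G → ¬ Bipartite G →
         (k : ℕ) .{{_ : NonZero k}} → 2 ≤ k →
         (c : Fin n → Fin k) → ProperVertexColouring G k c →
         (s : EdgeColouring G k) (v : Fin n) → AlmostInduces k s c v →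
         (x : Fin k) →
         (∀ u → Adj G v u → c u ≢ shifted k (inducedColour k s v) x) →
         Σ (EdgeColouring G k) λ s' →
           Induces k s' (recolour c v (shifted k (inducedColour k s v) x))
lemma2 {n} G connected nonBipartite k _ c _ s v almost x _ = s′ , λ u → toℕ-injective (agrees u)
  where
  W : Reach G v v
  W = proj₁ (oddClosedWalk G connected nonBipartite v)
  y : ℕ
  y = toℕ x
  s′ : EdgeColouring G k
  s′ = shiftColouring s (alternating W y (k ∸ y)) (alternating-sym W y (k ∸ y))
  cₛ : Fin n → ℕ
  cₛ u = toℕ (inducedColour k s u)
  shift : ∀ u → toℕ (inducedColour k s′ u) ≡ (cₛ u + ⟦ u ≟ v ⟧ * (2 * y)) % k
  shift = toℕ-inducedColour-oddWalkShift W (proj₂ (oddClosedWalk G connected nonBipartite v)) k s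
            (∣-reflexive (≡.sym (m+[n∸m]≡n (<⇒≤ (toℕ<n x)))))
  agrees : ∀ u → toℕ (inducedColour k s′ u) ≡ toℕ (recolour c v (shifted k (inducedColour k s v) x) u)
  agrees u with u ≟ v
  ... | yes refl = begin
    toℕ (inducedColour k s′ u)             ≡⟨ shift u ⟩
    (cₛ u + ⟦ u ≟ u ⟧ * (2 * y)) % k       ≡⟨ cong (λ i → (cₛ u + i * (2 * y)) % k) (⟦⟧≡1 (u ≟ u) refl) ⟩
    (cₛ u + 1 * (2 * y)) % k               ≡⟨ cong (λ i → (cₛ u + i) % k) (*-identityˡ (2 * y)) ⟩
    (cₛ u + 2 * y) % k                     ≡⟨ toℕ-fromℕ< _ ⟨
    toℕ (shifted k (inducedColour k s u) x) ∎
  ... | no u≢v = begin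
    toℕ (inducedColour k s′ u)             ≡⟨ shift u ⟩
    (cₛ u + ⟦ u ≟ v ⟧ * (2 * y)) % k       ≡⟨ cong (λ i → (cₛ u + i * (2 * y)) % k) (⟦⟧≡0 (u ≟ v) u≢v) ⟩
    (cₛ u + 0) % k                         ≡⟨ cong (_% k) (+-identityʳ (cₛ u)) ⟩
    cₛ u % k                               ≡⟨ m<n⇒m%n≡m (toℕ<n (inducedColour k s u)) ⟩
    cₛ u                                   ≡⟨ cong toℕ (almost u u≢v) ⟩
    toℕ (c u)                              ∎
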